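{- Let $s\ge 2$ and $t\ge 1$ be integers, and let $G$ be a graph with vertices $x,y,z\in V(G)$. Let $W\subseteq V(G)\setminus\{z\}$ be a vertex subset containing $x$ and $y$. Suppose there exist $s$ consecutive paths $P_1,\dots,P_s$ from $x$ to $y$ in the induced subgraph $G[W]$, and there exist $t$ admissible paths $Q_1,\dots,Q_t$ from $y$ to $z$ in $G-(W\setminus\{y\})$. Then there exist at least $s+t-1$ consecutive paths from $x$ to $z$ in $G$.
   Context: All graphs are finite, simple and undirected; the length of a path is its number of edges. Paths $P_1,\dots,P_m$ are called consecutive if their lengths are $\ell,\ell+1,\dots,\ell+m-1$ for some integer $\ell$. Paths $P_1,\dots,P_k$ are called admissible if $|E(P_1)|\ge 2$ and either $|E(P_{i+1})|-|E(P_i)|=1$ for all $i\in[k-1]$, or $|E(P_{i+1})|-|E(P_i)|=2$ for all $i\in[k-1]$. For $S\subseteq V(G)$, $G[S]$ is the induced subgraph on $S$ and $G-S$ is $G[V(G)\setminus S]$. -}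

module Defs where

open import Data.Nat using (ℕ; suc; _+_; _∸_; _≤_)
open import Data.Fin using (Fin)
open import Data.Fin.Subset using (Subset; _∈_; _∉_)
open import Data.List using (List; []; _∷_; length; head; last; map)
open import Data.List.Relation.Unary.All using (All)
open import Data.List.Relation.Unary.Linked using (Linked)
open import Data.List.Relation.Unary.Unique.Propositional using (Unique)
open import Data.Maybe using (just)
open import Data.Unit using (⊤)
open import Data.Product using (_×_)
open import Data.Sum using (_⊎_)
open import Relation.Binary.PropositionalEquality using (_≡_)
open import Relation.Nullary using (¬_)

record Graph (n : ℕ) : Set₁ where
  field
    Adj    : Fin n → Fin n → Set
    sym    : ∀ {u v} → Adj u v → Adj v u
    irrefl : ∀ {u} → ¬ Adj u u
open Graph public

IsPath : ∀ {n} → Graph n → Fin n → Fin n → List (Fin n) → Set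
IsPath G x y vs =
  (head vs ≡ just x) × (last vs ≡ just y) × Unique vs × Linked (Adj G) vs

len : ∀ {n} → List (Fin n) → ℕ
len vs = length vs ∸ 1

IsPathIn : ∀ {n} → Graph n → Subset n → Fin n → Fin n → List (Fin n) → Set
IsPathIn G W x y vs = IsPath G x y vs × All (_∈ W) vs

IsPathAvoiding : ∀ {n} → Graph n → Subset n → Fin n → Fin n → Fin n → List (Fin n) → Set
IsPathAvoiding G W y a b vs = IsPath G a b vs × All (λ v → v ∉ W ⊎ v ≡ y) vs

Consecutive : ∀ {n} → List (List (Fin n)) → Set
Consecutive Ps = Linked (λ p q → len q ≡ len p + 1) Ps

FirstAtLeast2 : ∀ {n} → List (List (Fin n)) → Set
FirstAtLeast2 []      = ⊤
FirstAtLeast2 (p ∷ _) = 2 ≤ len p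

Admissible : ∀ {n} → List (List (Fin n)) → Set
Admissible Qs = FirstAtLeast2 Qs ×
  (Linked (λ p q → len q ≡ len p + 1) Qs ⊎ Linked (λ p q → len q ≡ len p + 2) Qs)

module Submission where

-- Let P₁,…,Pₛ have lengths a,…,a+s−1 and Q₁,…,Qₜ lengths b, b+d, …, b+(t−1)d with
-- d ∈ {1,2}. As Pᵢ lies in W and Qⱼ meets W only in y, each concatenation PᵢQⱼ is an
-- x–z path of length |Pᵢ|+|Qⱼ|. For d = 1 the staircase P₁Q₁,…,P₁Qₜ,P₂Qₜ,…,PₛQₜ has
-- s+t−1 consecutive lengths; for d = 2 the zigzag P₁Q₁,P₂Q₁,P₁Q₂,P₂Q₂,…,P₁Qₜ,P₂Qₜ,
-- P₃Qₜ,…,PₛQₜ has 2t+s−2 ≥ s+t−1.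

open import Defs hiding (sym)
open import Data.Nat using (ℕ; suc; _+_; _∸_; _≤_; _≥_; s≤s; z≤n)
open import Data.Nat.Properties
  using (+-assoc; +-comm; +-suc; ≤-reflexive; ≤-trans; m≤n⇒m≤1+n; +-commutativeSemigroup)
open import Algebra.Properties.CommutativeSemigroup +-commutativeSemigroup using (xy∙z≈xz∙y)
open import Data.Fin using (Fin)
open import Data.Fin.Subset using (Subset; _∈_; _∉_)
open import Data.List using (List; []; _∷_; _++_; drop; map; length; last)
open import Data.List.Properties using (length-++; length-drop; length-map; ++-identityʳ)
open import Data.List.Membership.Propositional using () renaming (_∈_ to _∈ₗ_)
open import Data.List.Relation.Unary.All as All using (All; _∷_)
import Data.List.Relation.Unary.All.Properties as All
open import Data.List.Relation.Unary.Any using (there)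
open import Data.List.Relation.Unary.AllPairs using (_∷_)
open import Data.List.Relation.Unary.Linked as Linked using (Linked; _∷_)
import Data.List.Relation.Unary.Linked.Properties as Linked
import Data.List.Relation.Unary.Unique.Propositional.Properties as Unique
open import Data.Maybe using (just)
open import Data.Maybe.Properties using (just-injective)
open import Data.Maybe.Relation.Binary.Connected using (Connected; just)
open import Data.Product using (Σ; _×_; _,_)
open import Data.Sum using (inj₁; inj₂)
open import Data.Empty using (⊥-elim)
open import Relation.Binary.PropositionalEquality
  using (_≡_; refl; sym; trans; cong; subst; module ≡-Reasoning)

-- Concatenation at a shared endpoint: the first vertex of q is dropped. The []
-- clause makes  len (p ⊕ q) ≡ len p + len q  hold for all lists.
infixr 6 _⊕_
_⊕_ : ∀ {a} {A : Set a} → List A → List A → List A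
[]      ⊕ q = q
(v ∷ p) ⊕ q = v ∷ p ++ drop 1 q

last-++-∷ : ∀ {a} {A : Set a} (xs : List A) y ys → last (xs ++ y ∷ ys) ≡ last (y ∷ ys)
last-++-∷ []           y ys = refl
last-++-∷ (x ∷ [])     y ys = refl
last-++-∷ (x ∷ x′ ∷ xs) y ys = last-++-∷ (x′ ∷ xs) y ys

module _ {n} (G : Graph n) where

  ⊕-isPath : ∀ {x y z p q} → IsPath G x y p → IsPath G y z q →
             (∀ {v} → v ∈ₗ p → v ∈ₗ q → v ≡ y) → IsPath G x z (p ⊕ q)
  ⊕-isPath {p = v ∷ p} {_ ∷ []} hp (refl , yz , _) _ =
    subst (λ w → IsPath G _ w (v ∷ p ++ [])) (just-injective yz)
      (subst (IsPath G _ _) (sym (++-identityʳ (v ∷ p))) hp)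
  ⊕-isPath {p = v ∷ p} {_ ∷ c ∷ r} (refl , py , up , lp) (refl , cz , y∉cr ∷ ucr , yc ∷ lcr) meet =
    refl ,
    trans (last-++-∷ (v ∷ p) c r) cz ,
    Unique.++⁺ up ucr (λ (v∈p , v∈cr) → All.lookup y∉cr v∈cr (sym (meet v∈p (there v∈cr)))) ,
    Linked.++⁺ lp (subst (λ w → Connected (Adj G) w (just c)) (sym py) (just yc)) lcr

  ⊕-isPathIn-isPathAvoiding : ∀ {W x y z p q} → IsPathIn G W x y p →
                              IsPathAvoiding G W y y z q → IsPath G x z (p ⊕ q)
  ⊕-isPathIn-isPathAvoiding {y = y} {p = p} {q} (hp , p⊆W) (hq , q-avoids) = ⊕-isPath hp hq meet
    where
    meet : ∀ {v} → v ∈ₗ p → v ∈ₗ q → v ≡ y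
    meet v∈p v∈q with All.lookup q-avoids v∈q
    ... | inj₁ v∉W = ⊥-elim (v∉W (All.lookup p⊆W v∈p))
    ... | inj₂ v≡y = v≡y

module _ {n : ℕ} where

  Stepped : ℕ → List (List (Fin n)) → Set
  Stepped k = Linked (λ p q → len q ≡ len p + k)

  len-⊕ : (p q : List (Fin n)) → len (p ⊕ q) ≡ len p + len q
  len-⊕ []      q = refl
  len-⊕ (v ∷ p) q = trans (length-++ p) (cong (length p +_) (length-drop 1 q))

  ⊕-stepˡ : ∀ {k} p p′ q → len p′ ≡ len p + k → len (p′ ⊕ q) ≡ len (p ⊕ q) + k
  ⊕-stepˡ {k} p p′ q e = begin
    len (p′ ⊕ q)        ≡⟨ len-⊕ p′ q ⟩
    len p′ + len q      ≡⟨ cong (_+ len q) e ⟩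
    len p + k + len q   ≡⟨ xy∙z≈xz∙y (len p) k (len q) ⟩
    len p + len q + k   ≡⟨ cong (_+ k) (sym (len-⊕ p q)) ⟩
    len (p ⊕ q) + k     ∎
    where open ≡-Reasoning

  ⊕-stepʳ : ∀ {k} p q q′ → len q′ ≡ len q + k → len (p ⊕ q′) ≡ len (p ⊕ q) + k
  ⊕-stepʳ {k} p q q′ e = begin
    len (p ⊕ q′)        ≡⟨ len-⊕ p q′ ⟩
    len p + len q′      ≡⟨ cong (len p +_) e ⟩
    len p + (len q + k) ≡⟨ sym (+-assoc (len p) (len q) k) ⟩
    len p + len q + k   ≡⟨ cong (_+ k) (sym (len-⊕ p q)) ⟩
    len (p ⊕ q) + k     ∎
    where open ≡-Reasoning

  zigzag-turn : ∀ p₁ p₂ q q′ → len p₂ ≡ len p₁ + 1 → len q′ ≡ len q + 2 →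
                len (p₁ ⊕ q′) ≡ len (p₂ ⊕ q) + 1
  zigzag-turn p₁ p₂ q q′ e₁ e = begin
    len (p₁ ⊕ q′)         ≡⟨ ⊕-stepʳ p₁ q q′ e ⟩
    len (p₁ ⊕ q) + 2      ≡⟨ sym (+-assoc (len (p₁ ⊕ q)) 1 1) ⟩
    len (p₁ ⊕ q) + 1 + 1  ≡⟨ cong (_+ 1) (sym (⊕-stepˡ p₁ p₂ q e₁)) ⟩
    len (p₂ ⊕ q) + 1      ∎
    where open ≡-Reasoning

  staircase : List (Fin n) → List (Fin n) → List (List (Fin n)) → List (List (Fin n)) →
              List (List (Fin n))
  staircase p q []        ps = map (_⊕ q) (p ∷ ps)
  staircase p q (q′ ∷ qs) ps = p ⊕ q ∷ staircase p q′ qs ps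

  zigzag : List (Fin n) → List (Fin n) → List (Fin n) → List (List (Fin n)) →
           List (List (Fin n)) → List (List (Fin n))
  zigzag p₁ p₂ q []        ps = map (_⊕ q) (p₁ ∷ p₂ ∷ ps)
  zigzag p₁ p₂ q (q′ ∷ qs) ps = p₁ ⊕ q ∷ p₂ ⊕ q ∷ zigzag p₁ p₂ q′ qs ps

  map-⊕-stepped : ∀ {k} q {ps} → Stepped k ps → Stepped k (map (_⊕ q) ps)
  map-⊕-stepped q s = Linked.map⁺ (Linked.map (λ {p} {p′} → ⊕-stepˡ p p′ q) s)

  -- Here and in zigzag-consecutive the two recursive clauses coincide; splitting
  -- qs only makes the head of the recursively built list reduce.
  staircase-consecutive : ∀ {p q qs ps} → Consecutive (p ∷ ps) → Consecutive (q ∷ qs) →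
                          Consecutive (staircase p q qs ps)
  staircase-consecutive {q = q} {[]} cp _ = map-⊕-stepped q cp
  staircase-consecutive {p} {q} {q′ ∷ []} cp (e ∷ cq) =
    ⊕-stepʳ p q q′ e ∷ staircase-consecutive cp cq
  staircase-consecutive {p} {q} {q′ ∷ _ ∷ _} cp (e ∷ cq) =
    ⊕-stepʳ p q q′ e ∷ staircase-consecutive cp cq

  zigzag-consecutive : ∀ {p₁ p₂ q qs ps} → Consecutive (p₁ ∷ p₂ ∷ ps) → Stepped 2 (q ∷ qs) →
                       Consecutive (zigzag p₁ p₂ q qs ps)
  zigzag-consecutive {q = q} {[]} cp _ = map-⊕-stepped q cp
  zigzag-consecutive {p₁} {p₂} {q} {q′ ∷ []} cp@(e₁ ∷ _) (e ∷ cq) =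
    ⊕-stepˡ p₁ p₂ q e₁ ∷ zigzag-turn p₁ p₂ q q′ e₁ e ∷ zigzag-consecutive cp cq
  zigzag-consecutive {p₁} {p₂} {q} {q′ ∷ _ ∷ _} cp@(e₁ ∷ _) (e ∷ cq) =
    ⊕-stepˡ p₁ p₂ q e₁ ∷ zigzag-turn p₁ p₂ q q′ e₁ e ∷ zigzag-consecutive cp cq

  length-staircase : ∀ p q qs ps →
                     length (staircase p q qs ps) ≡ length (p ∷ ps) + length (q ∷ qs) ∸ 1
  length-staircase p q []        ps = trans (length-map (_⊕ q) (p ∷ ps)) (+-comm 1 (length ps))
  length-staircase p q (q′ ∷ qs) ps =
    trans (cong suc (length-staircase p q′ qs ps)) (sym (+-suc (length ps) (suc (length qs))))

  length-zigzag : ∀ p₁ p₂ q qs ps →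
                  length (p₁ ∷ p₂ ∷ ps) + length (q ∷ qs) ∸ 1 ≤ length (zigzag p₁ p₂ q qs ps)
  length-zigzag p₁ p₂ q [] ps =
    ≤-reflexive (trans (cong suc (+-comm (length ps) 1)) (sym (length-map (_⊕ q) (p₁ ∷ p₂ ∷ ps))))
  length-zigzag p₁ p₂ q (q′ ∷ qs) ps =
    ≤-trans (≤-reflexive (cong suc (+-suc (length ps) (suc (length qs)))))
            (s≤s (m≤n⇒m≤1+n (length-zigzag p₁ p₂ q′ qs ps)))

  module _ {P Q R : List (Fin n) → Set} (join : ∀ {p q} → P p → Q q → R (p ⊕ q)) where

    staircase-all : ∀ {p q qs ps} → P p → All P ps → All Q (q ∷ qs) →
                    All R (staircase p q qs ps)
    staircase-all {qs = []}    pp pps (qq ∷ _)   = All.map⁺ (All.map (λ p → join p qq) (pp ∷ pps))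
    staircase-all {qs = _ ∷ _} pp pps (qq ∷ qqs) = join pp qq ∷ staircase-all pp pps qqs

    zigzag-all : ∀ {p₁ p₂ q qs ps} → P p₁ → P p₂ → All P ps → All Q (q ∷ qs) →
                 All R (zigzag p₁ p₂ q qs ps)
    zigzag-all {qs = []} pp₁ pp₂ pps (qq ∷ _) =
      All.map⁺ (All.map (λ p → join p qq) (pp₁ ∷ pp₂ ∷ pps))
    zigzag-all {qs = _ ∷ _} pp₁ pp₂ pps (qq ∷ qqs) =
      join pp₁ qq ∷ join pp₂ qq ∷ zigzag-all pp₁ pp₂ pps qqs

lemma2p3 : ∀ {n} (s t : ℕ) → 2 ≤ s → 1 ≤ t →
    (G : Graph n) (x y z : Fin n) (W : Subset n) →
    z ∉ W → x ∈ W → y ∈ W →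
    (Ps : List (List (Fin n))) → length Ps ≡ s → Consecutive Ps →
    All (IsPathIn G W x y) Ps →
    (Qs : List (List (Fin n))) → length Qs ≡ t → Admissible Qs →
    All (IsPathAvoiding G W y y z) Qs →
    Σ (List (List (Fin n))) (λ Rs →
      (length Rs ≥ s + t ∸ 1) × Consecutive Rs × All (IsPath G x z) Rs)
lemma2p3 _ _ (s≤s (s≤s z≤n)) (s≤s z≤n) G _ _ _ _ _ _ _
    (p₁ ∷ p₂ ∷ ps) refl cP (pp₁ ∷ pps) (q ∷ qs) refl (_ , inj₁ cQ) pqs =
  staircase p₁ q qs (p₂ ∷ ps) ,
  ≤-reflexive (sym (length-staircase p₁ q qs (p₂ ∷ ps))) ,
  staircase-consecutive cP cQ ,
  staircase-all (⊕-isPathIn-isPathAvoiding G) pp₁ pps pqs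
lemma2p3 _ _ (s≤s (s≤s z≤n)) (s≤s z≤n) G _ _ _ _ _ _ _
    (p₁ ∷ p₂ ∷ ps) refl cP (pp₁ ∷ pp₂ ∷ pps) (q ∷ qs) refl (_ , inj₂ cQ) pqs =
  zigzag p₁ p₂ q qs ps ,
  length-zigzag p₁ p₂ q qs ps ,
  zigzag-consecutive cP cQ ,
  zigzag-all (⊕-isPathIn-isPathAvoiding G) pp₁ pp₂ pps pqs
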